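{- Let $M\mapsto M^*$ be the translation from the untyped delimited control calculus to the untyped effect handler calculus that is homomorphic on all core constructs and satisfies $(\mathcal{S}_0k.N)^*=\mathit{shift0}\,\{\lambda k.N^*\}$ and $\langle M\mid x.N\rangle^*=\mathtt{handle}\,M^*\,\mathtt{with}\,\{\mathtt{return}\,x\mapsto N^*\}\uplus\{\mathit{shift0}\,y\,f\mapsto y!\,f\}$, where $\mathit{shift0}$ is a fixed operation name. Then for all computations $M,N$ of the delimited control calculus, $M\to N$ implies $M^*\to^{+}N^*$.
   Context: Core syntax (shared). Values $V ::= x \mid () \mid (V_1,V_2) \mid \ell\,V \mid \{M\}$; computations $M,N ::= \mathtt{let}\,(x,y)=V\,\mathtt{in}\,M \mid \mathtt{case}\,V\,\mathtt{of}\,\{\ell_i x_i\mapsto M_i\}_i \mid V! \mid \mathtt{return}\,V \mid \mathtt{let}\,x\Leftarrow M\,\mathtt{in}\,N \mid \lambda x.M \mid M\,V \mid \langle M_1,M_2\rangle \mid \mathrm{prj}_i M$. Core $\beta$-rules: $\mathtt{let}\,(x,y)=(V_1,V_2)\,\mathtt{in}\,M \to_\beta M[V_1/x,V_2/y]$; $\mathtt{case}\,\ell_j V\,\mathtt{of}\,\{\dots\ell_j x_j\mapsto M_j\dots\}\to_\beta M_j[V/x_j]$; $\{M\}!\to_\beta M$; $\mathtt{let}\,x\Leftarrow\mathtt{return}\,V\,\mathtt{in}\,N\to_\beta N[V/x]$; $(\lambda x.M)V\to_\beta M[V/x]$; $\mathrm{prj}_i\langle M_1,M_2\rangle\to_\beta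 M_i$. Basic frames $B ::= \mathtt{let}\,x\Leftarrow[\,]\,\mathtt{in}\,N\mid[\,]\,V\mid\mathrm{prj}_i[\,]$; hoisting contexts $\mathcal{H}::=[\,]\mid\mathcal{H}[B]$. In each calculus $M\to N$ iff $M=K[M']$, $N=K[N']$ with $M'\to_\beta N'$ and $K$ an evaluation context of that calculus; $\to^+$ is the transitive closure. Delimited control calculus: adds computations $\mathcal{S}_0k.M$ and $\langle M\mid x.N\rangle$; evaluation contexts $K::=[\,]\mid K[B]\mid K[\langle[\,]\mid x.N\rangle]$; extra rules $\langle\mathtt{return}\,V\mid x.N\rangle\to_\beta N[V/x]$ and $\langle\mathcal{H}[\mathcal{S}_0k.M]\mid x.N\rangle\to_\beta M[\{\lambda y.\langle\mathcal{H}[\mathtt{return}\,y]\mid x.N\rangle\}/k]$. Effect handler calculus: operation names $\mathit{op}$; adds computations $\mathit{op}\,V$ and $\mathtt{handle}\,M\,\mathtt{with}\,H$, where $H$ has a return clause $\mathtt{return}\,x\mapsto N_{\mathrm{ret}}$ and operation clauses $\mathit{op}\,p\,k\mapsto N_{\mathit{op}}$ for $\mathit{op}$ in a finite set $\mathrm{ops}(H)$; evaluation contexts $K::=[\,]\mid K[B]\mid K[\mathtt{handle}\,[\,]\,\mathtt{with}\,H]$; extra rules $\mathtt{handle}\,(\mathtt{return}\,V)\,\mathtt{with}\,H\to_\beta N_{\mathrm{ret}}[V/x]$ and $\mathtt{handle}\,\mathcal{H}[\mathit{op}\,V]\,\mathtt{with}\,H\to_\beta N_{\mathit{op}}[V/p,\{\lambda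 y.\mathtt{handle}\,\mathcal{H}[\mathtt{return}\,y]\,\mathtt{with}\,H\}/k]$ for $\mathit{op}\in\mathrm{ops}(H)$. -}

module Defs where

open import Data.Nat using (ℕ; zero; suc; _≟_)
open import Data.Fin using (Fin; zero; suc)
open import Data.Maybe using (Maybe; just; nothing)
open import Data.List using (List; []; _∷_)
open import Relation.Nullary using (yes; no)
open import Relation.Binary.PropositionalEquality using (_≡_)

Label : Set
Label = ℕ

Op : Set
Op = ℕ

-- Binder conventions:
--   let (x,y) = V in M  : M : Comp (2+n), x = index 0, y = index 1
--   op clause  op p k ↦ N : N : Comp (2+n), p = index 0, k = index 1
--   all other binders bind index 0.

Ren : ℕ → ℕ → Set
Ren n m = Fin n → Fin m

ext : ∀ {n m} → Ren n m → Ren (suc n) (suc m)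
ext ρ zero    = zero
ext ρ (suc i) = suc (ρ i)

module Del where

  mutual
    data Val (n : ℕ) : Set where
      var   : Fin n → Val n
      unit  : Val n
      pair  : Val n → Val n → Val n
      inj   : Label → Val n → Val n
      thunk : Comp n → Val n

    data Comp (n : ℕ) : Set where
      split  : Val n → Comp (suc (suc n)) → Comp n
      case   : Val n → Branches n → Comp n
      force  : Val n → Comp n
      ret    : Val n → Comp n
      bind   : Comp n → Comp (suc n) → Comp n
      lam    : Comp (suc n) → Comp n
      app    : Comp n → Val n → Comp n
      pairC  : Comp n → Comp n → Comp n
      prj₁   : Comp n → Comp n
      prj₂   : Comp n → Comp n
      shift0 : Comp (suc n) → Comp n
      reset  : Comp n → Comp (suc n) → Comp n

    data Branches (n : ℕ) : Set where
      []     : Branches n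
      _↦_∷_ : Label → Comp (suc n) → Branches n → Branches n

  mutual
    renV : ∀ {n m} → Ren n m → Val n → Val m
    renV ρ (var i)    = var (ρ i)
    renV ρ unit       = unit
    renV ρ (pair V W) = pair (renV ρ V) (renV ρ W)
    renV ρ (inj ℓ V)  = inj ℓ (renV ρ V)
    renV ρ (thunk M)  = thunk (renC ρ M)

    renC : ∀ {n m} → Ren n m → Comp n → Comp m
    renC ρ (split V M)  = split (renV ρ V) (renC (ext (ext ρ)) M)
    renC ρ (case V bs)  = case (renV ρ V) (renB ρ bs)
    renC ρ (force V)    = force (renV ρ V)
    renC ρ (ret V)      = ret (renV ρ V)
    renC ρ (bind M N)   = bind (renC ρ M) (renC (ext ρ) N)
    renC ρ (lam M)      = lam (renC (ext ρ) M)
    renC ρ (app M V)    = app (renC ρ M) (renV ρ V)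
    renC ρ (pairC M N)  = pairC (renC ρ M) (renC ρ N)
    renC ρ (prj₁ M)     = prj₁ (renC ρ M)
    renC ρ (prj₂ M)     = prj₂ (renC ρ M)
    renC ρ (shift0 M)   = shift0 (renC (ext ρ) M)
    renC ρ (reset M N)  = reset (renC ρ M) (renC (ext ρ) N)

    renB : ∀ {n m} → Ren n m → Branches n → Branches m
    renB ρ []             = []
    renB ρ (ℓ ↦ M ∷ bs)  = ℓ ↦ renC (ext ρ) M ∷ renB ρ bs

  Sub : ℕ → ℕ → Set
  Sub n m = Fin n → Val m

  exts : ∀ {n m} → Sub n m → Sub (suc n) (suc m)
  exts σ zero    = var zero
  exts σ (suc i) = renV suc (σ i)

  mutual
    subV : ∀ {n m} → Sub n m → Val n → Val m
    subV σ (var i)    = σ i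
    subV σ unit       = unit
    subV σ (pair V W) = pair (subV σ V) (subV σ W)
    subV σ (inj ℓ V)  = inj ℓ (subV σ V)
    subV σ (thunk M)  = thunk (subC σ M)

    subC : ∀ {n m} → Sub n m → Comp n → Comp m
    subC σ (split V M)  = split (subV σ V) (subC (exts (exts σ)) M)
    subC σ (case V bs)  = case (subV σ V) (subB σ bs)
    subC σ (force V)    = force (subV σ V)
    subC σ (ret V)      = ret (subV σ V)
    subC σ (bind M N)   = bind (subC σ M) (subC (exts σ) N)
    subC σ (lam M)      = lam (subC (exts σ) M)
    subC σ (app M V)    = app (subC σ M) (subV σ V)
    subC σ (pairC M N)  = pairC (subC σ M) (subC σ N)
    subC σ (prj₁ M)     = prj₁ (subC σ M)
    subC σ (prj₂ M)     = prj₂ (subC σ M)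
    subC σ (shift0 M)   = shift0 (subC (exts σ) M)
    subC σ (reset M N)  = reset (subC σ M) (subC (exts σ) N)

    subB : ∀ {n m} → Sub n m → Branches n → Branches m
    subB σ []             = []
    subB σ (ℓ ↦ M ∷ bs)  = ℓ ↦ subC (exts σ) M ∷ subB σ bs

  _[_]₁ : ∀ {n} → Comp (suc n) → Val n → Comp n
  M [ V ]₁ = subC σ M
    where σ : Sub _ _
          σ zero    = V
          σ (suc i) = var i

  _[_,_]₂ : ∀ {n} → Comp (suc (suc n)) → Val n → Val n → Comp n
  M [ V₁ , V₂ ]₂ = subC σ M
    where σ : Sub _ _
          σ zero          = V₁
          σ (suc zero)    = V₂
          σ (suc (suc i)) = var i

  lookupB : ∀ {n} → Label → Branches n → Maybe (Comp (suc n))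
  lookupB ℓ []            = nothing
  lookupB ℓ (ℓ' ↦ M ∷ bs) with ℓ ≟ ℓ'
  ... | yes _ = just M
  ... | no  _ = lookupB ℓ bs

  data BFrame (n : ℕ) : Set where
    bindF : Comp (suc n) → BFrame n
    appF  : Val n → BFrame n
    prj₁F : BFrame n
    prj₂F : BFrame n

  plugB : ∀ {n} → BFrame n → Comp n → Comp n
  plugB (bindF N) M = bind M N
  plugB (appF V)  M = app M V
  plugB prj₁F     M = prj₁ M
  plugB prj₂F     M = prj₂ M

  renBF : ∀ {n m} → Ren n m → BFrame n → BFrame m
  renBF ρ (bindF N) = bindF (renC (ext ρ) N)
  renBF ρ (appF V)  = appF (renV ρ V)
  renBF ρ prj₁F     = prj₁F
  renBF ρ prj₂F     = prj₂F

  -- hoisting contexts: list of basic frames, innermost frame first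
  HCtx : ℕ → Set
  HCtx n = List (BFrame n)

  plugH : ∀ {n} → HCtx n → Comp n → Comp n
  plugH []      M = M
  plugH (B ∷ H) M = plugH H (plugB B M)

  renH : ∀ {n m} → Ren n m → HCtx n → HCtx m
  renH ρ []      = []
  renH ρ (B ∷ H) = renBF ρ B ∷ renH ρ H

  -- evaluation contexts K ::= [] | K[B] | K[⟨ [] | x.N ⟩], innermost frame first
  data EFrame (n : ℕ) : Set where
    basic  : BFrame n → EFrame n
    resetF : Comp (suc n) → EFrame n

  plugF : ∀ {n} → EFrame n → Comp n → Comp n
  plugF (basic B)  M = plugB B M
  plugF (resetF N) M = reset M N

  ECtx : ℕ → Set
  ECtx n = List (EFrame n)

  plugE : ∀ {n} → ECtx n → Comp n → Comp n
  plugE []      M = M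
  plugE (F ∷ K) M = plugE K (plugF F M)

  infix 4 _→β_ _⟶_
  data _→β_ {n : ℕ} : Comp n → Comp n → Set where
    β-split : ∀ {V₁ V₂ M} → split (pair V₁ V₂) M →β M [ V₁ , V₂ ]₂
    β-case  : ∀ {ℓ V bs M} → lookupB ℓ bs ≡ just M → case (inj ℓ V) bs →β M [ V ]₁
    β-force : ∀ {M} → force (thunk M) →β M
    β-bind  : ∀ {V N} → bind (ret V) N →β N [ V ]₁
    β-lam   : ∀ {M V} → app (lam M) V →β M [ V ]₁
    β-prj₁  : ∀ {M₁ M₂} → prj₁ (pairC M₁ M₂) →β M₁
    β-prj₂  : ∀ {M₁ M₂} → prj₂ (pairC M₁ M₂) →β M₂
    β-ret   : ∀ {V N} → reset (ret V) N →β N [ V ]₁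
    β-shift : ∀ (H : HCtx n) {M N} →
      reset (plugH H (shift0 M)) N →β
      M [ thunk (lam (reset (plugH (renH suc H) (ret (var zero))) (renC (ext suc) N))) ]₁

  data _⟶_ {n : ℕ} : Comp n → Comp n → Set where
    step : ∀ (K : ECtx n) {M N} → M →β N → plugE K M ⟶ plugE K N

module Eff where

  mutual
    data Val (n : ℕ) : Set where
      var   : Fin n → Val n
      unit  : Val n
      pair  : Val n → Val n → Val n
      inj   : Label → Val n → Val n
      thunk : Comp n → Val n

    data Comp (n : ℕ) : Set where
      split  : Val n → Comp (suc (suc n)) → Comp n
      case   : Val n → Branches n → Comp n
      force  : Val n → Comp n
      ret    : Val n → Comp n
      bind   : Comp n → Comp (suc n) → Comp n
      lam    : Comp (suc n) → Comp n
      app    : Comp n → Val n → Comp n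
      pairC  : Comp n → Comp n → Comp n
      prj₁   : Comp n → Comp n
      prj₂   : Comp n → Comp n
      op     : Op → Val n → Comp n
      handle : Comp n → Handler n → Comp n

    data Branches (n : ℕ) : Set where
      []     : Branches n
      _↦_∷_ : Label → Comp (suc n) → Branches n → Branches n

    data Handler (n : ℕ) : Set where
      handler : Comp (suc n) → OpClauses n → Handler n

    data OpClauses (n : ℕ) : Set where
      []     : OpClauses n
      _↦_∷_ : Op → Comp (suc (suc n)) → OpClauses n → OpClauses n

  mutual
    renV : ∀ {n m} → Ren n m → Val n → Val m
    renV ρ (var i)    = var (ρ i)
    renV ρ unit       = unit
    renV ρ (pair V W) = pair (renV ρ V) (renV ρ W)
    renV ρ (inj ℓ V)  = inj ℓ (renV ρ V)
    renV ρ (thunk M)  = thunk (renC ρ M)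

    renC : ∀ {n m} → Ren n m → Comp n → Comp m
    renC ρ (split V M)  = split (renV ρ V) (renC (ext (ext ρ)) M)
    renC ρ (case V bs)  = case (renV ρ V) (renB ρ bs)
    renC ρ (force V)    = force (renV ρ V)
    renC ρ (ret V)      = ret (renV ρ V)
    renC ρ (bind M N)   = bind (renC ρ M) (renC (ext ρ) N)
    renC ρ (lam M)      = lam (renC (ext ρ) M)
    renC ρ (app M V)    = app (renC ρ M) (renV ρ V)
    renC ρ (pairC M N)  = pairC (renC ρ M) (renC ρ N)
    renC ρ (prj₁ M)     = prj₁ (renC ρ M)
    renC ρ (prj₂ M)     = prj₂ (renC ρ M)
    renC ρ (op o V)     = op o (renV ρ V)
    renC ρ (handle M H) = handle (renC ρ M) (renHd ρ H)

    renB : ∀ {n m} → Ren n m → Branches n → Branches m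
    renB ρ []             = []
    renB ρ (ℓ ↦ M ∷ bs)  = ℓ ↦ renC (ext ρ) M ∷ renB ρ bs

    renHd : ∀ {n m} → Ren n m → Handler n → Handler m
    renHd ρ (handler R cs) = handler (renC (ext ρ) R) (renO ρ cs)

    renO : ∀ {n m} → Ren n m → OpClauses n → OpClauses m
    renO ρ []            = []
    renO ρ (o ↦ N ∷ cs) = o ↦ renC (ext (ext ρ)) N ∷ renO ρ cs

  Sub : ℕ → ℕ → Set
  Sub n m = Fin n → Val m

  exts : ∀ {n m} → Sub n m → Sub (suc n) (suc m)
  exts σ zero    = var zero
  exts σ (suc i) = renV suc (σ i)

  mutual
    subV : ∀ {n m} → Sub n m → Val n → Val m
    subV σ (var i)    = σ i
    subV σ unit       = unit
    subV σ (pair V W) = pair (subV σ V) (subV σ W)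
    subV σ (inj ℓ V)  = inj ℓ (subV σ V)
    subV σ (thunk M)  = thunk (subC σ M)

    subC : ∀ {n m} → Sub n m → Comp n → Comp m
    subC σ (split V M)  = split (subV σ V) (subC (exts (exts σ)) M)
    subC σ (case V bs)  = case (subV σ V) (subB σ bs)
    subC σ (force V)    = force (subV σ V)
    subC σ (ret V)      = ret (subV σ V)
    subC σ (bind M N)   = bind (subC σ M) (subC (exts σ) N)
    subC σ (lam M)      = lam (subC (exts σ) M)
    subC σ (app M V)    = app (subC σ M) (subV σ V)
    subC σ (pairC M N)  = pairC (subC σ M) (subC σ N)
    subC σ (prj₁ M)     = prj₁ (subC σ M)
    subC σ (prj₂ M)     = prj₂ (subC σ M)
    subC σ (op o V)     = op o (subV σ V)
    subC σ (handle M H) = handle (subC σ M) (subHd σ H)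

    subB : ∀ {n m} → Sub n m → Branches n → Branches m
    subB σ []             = []
    subB σ (ℓ ↦ M ∷ bs)  = ℓ ↦ subC (exts σ) M ∷ subB σ bs

    subHd : ∀ {n m} → Sub n m → Handler n → Handler m
    subHd σ (handler R cs) = handler (subC (exts σ) R) (subO σ cs)

    subO : ∀ {n m} → Sub n m → OpClauses n → OpClauses m
    subO σ []            = []
    subO σ (o ↦ N ∷ cs) = o ↦ subC (exts (exts σ)) N ∷ subO σ cs

  _[_]₁ : ∀ {n} → Comp (suc n) → Val n → Comp n
  M [ V ]₁ = subC σ M
    where σ : Sub _ _
          σ zero    = V
          σ (suc i) = var i

  _[_,_]₂ : ∀ {n} → Comp (suc (suc n)) → Val n → Val n → Comp n
  M [ V₁ , V₂ ]₂ = subC σ M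
    where σ : Sub _ _
          σ zero          = V₁
          σ (suc zero)    = V₂
          σ (suc (suc i)) = var i

  lookupB : ∀ {n} → Label → Branches n → Maybe (Comp (suc n))
  lookupB ℓ []            = nothing
  lookupB ℓ (ℓ' ↦ M ∷ bs) with ℓ ≟ ℓ'
  ... | yes _ = just M
  ... | no  _ = lookupB ℓ bs

  lookupO : ∀ {n} → Op → OpClauses n → Maybe (Comp (suc (suc n)))
  lookupO o []             = nothing
  lookupO o (o' ↦ N ∷ cs) with o ≟ o'
  ... | yes _ = just N
  ... | no  _ = lookupO o cs

  data BFrame (n : ℕ) : Set where
    bindF : Comp (suc n) → BFrame n
    appF  : Val n → BFrame n
    prj₁F : BFrame n
    prj₂F : BFrame n

  plugB : ∀ {n} → BFrame n → Comp n → Comp n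
  plugB (bindF N) M = bind M N
  plugB (appF V)  M = app M V
  plugB prj₁F     M = prj₁ M
  plugB prj₂F     M = prj₂ M

  renBF : ∀ {n m} → Ren n m → BFrame n → BFrame m
  renBF ρ (bindF N) = bindF (renC (ext ρ) N)
  renBF ρ (appF V)  = appF (renV ρ V)
  renBF ρ prj₁F     = prj₁F
  renBF ρ prj₂F     = prj₂F

  HCtx : ℕ → Set
  HCtx n = List (BFrame n)

  plugH : ∀ {n} → HCtx n → Comp n → Comp n
  plugH []      M = M
  plugH (B ∷ H) M = plugH H (plugB B M)

  renH : ∀ {n m} → Ren n m → HCtx n → HCtx m
  renH ρ []      = []
  renH ρ (B ∷ H) = renBF ρ B ∷ renH ρ H

  -- evaluation contexts K ::= [] | K[B] | K[handle [] with H], innermost first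
  data EFrame (n : ℕ) : Set where
    basic   : BFrame n → EFrame n
    handleF : Handler n → EFrame n

  plugF : ∀ {n} → EFrame n → Comp n → Comp n
  plugF (basic B)   M = plugB B M
  plugF (handleF H) M = handle M H

  ECtx : ℕ → Set
  ECtx n = List (EFrame n)

  plugE : ∀ {n} → ECtx n → Comp n → Comp n
  plugE []      M = M
  plugE (F ∷ K) M = plugE K (plugF F M)

  infix 4 _→β_ _⟶_
  data _→β_ {n : ℕ} : Comp n → Comp n → Set where
    β-split : ∀ {V₁ V₂ M} → split (pair V₁ V₂) M →β M [ V₁ , V₂ ]₂
    β-case  : ∀ {ℓ V bs M} → lookupB ℓ bs ≡ just M → case (inj ℓ V) bs →β M [ V ]₁
    β-force : ∀ {M} → force (thunk M) →β M
    β-bind  : ∀ {V N} → bind (ret V) N →β N [ V ]₁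
    β-lam   : ∀ {M V} → app (lam M) V →β M [ V ]₁
    β-prj₁  : ∀ {M₁ M₂} → prj₁ (pairC M₁ M₂) →β M₁
    β-prj₂  : ∀ {M₁ M₂} → prj₂ (pairC M₁ M₂) →β M₂
    β-ret   : ∀ {V R cs} → handle (ret V) (handler R cs) →β R [ V ]₁
    β-op    : ∀ (H : HCtx n) {o V R cs N} → lookupO o cs ≡ just N →
      handle (plugH H (op o V)) (handler R cs) →β
      N [ V , thunk (lam (handle (plugH (renH suc H) (ret (var zero))) (renHd suc (handler R cs)))) ]₂

  data _⟶_ {n : ℕ} : Comp n → Comp n → Set where
    step : ∀ (K : ECtx n) {M N} → M →β N → plugE K M ⟶ plugE K N

shift0op : Op
shift0op = 0

mutual
  transV : ∀ {n} → Del.Val n → Eff.Val n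
  transV (Del.var i)    = Eff.var i
  transV Del.unit       = Eff.unit
  transV (Del.pair V W) = Eff.pair (transV V) (transV W)
  transV (Del.inj ℓ V)  = Eff.inj ℓ (transV V)
  transV (Del.thunk M)  = Eff.thunk (transC M)

  transC : ∀ {n} → Del.Comp n → Eff.Comp n
  transC (Del.split V M)  = Eff.split (transV V) (transC M)
  transC (Del.case V bs)  = Eff.case (transV V) (transB bs)
  transC (Del.force V)    = Eff.force (transV V)
  transC (Del.ret V)      = Eff.ret (transV V)
  transC (Del.bind M N)   = Eff.bind (transC M) (transC N)
  transC (Del.lam M)      = Eff.lam (transC M)
  transC (Del.app M V)    = Eff.app (transC M) (transV V)
  transC (Del.pairC M N)  = Eff.pairC (transC M) (transC N)
  transC (Del.prj₁ M)     = Eff.prj₁ (transC M)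
  transC (Del.prj₂ M)     = Eff.prj₂ (transC M)
  transC (Del.shift0 N)   = Eff.op shift0op (Eff.thunk (Eff.lam (transC N)))
  transC (Del.reset M N)  =
    Eff.handle (transC M)
      (Eff.handler (transC N)
        (Eff._↦_∷_ shift0op (Eff.app (Eff.force (Eff.var zero)) (Eff.var (suc zero))) Eff.[]))

  transB : ∀ {n} → Del.Branches n → Eff.Branches n
  transB Del.[]             = Eff.[]
  transB (Del._↦_∷_ ℓ M bs) = Eff._↦_∷_ ℓ (transC M) (transB bs)

-- The translation is compositional: it commutes with renaming, substitution
-- and plugging into contexts, and sends evaluation contexts to evaluation
-- contexts.  Hence every core β-step, and the return step of a reset, is
-- simulated by exactly the corresponding step.  A shift step is simulated in
-- three: the handler performs shift0 with the captured continuation κ,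
-- yielding {λk.M*}! κ, which forces and then β-reduces to M*[κ/k]; and κ is
-- precisely the translation of the continuation captured by S₀.
module Submission where

open import Defs
open import Data.Nat using (suc; _≟_)
open import Data.Fin using (zero; suc)
open import Data.Maybe using (just)
open import Data.List using ([]; _∷_)
open import Relation.Nullary using (yes; no)
open import Relation.Binary.PropositionalEquality using (_≡_; refl; sym; trans; cong; cong₂)
open import Relation.Binary.Construct.Closure.Transitive using (TransClosure; [_]; _∷_)

mutual
  transV-renV : ∀ {n m} (ρ : Ren n m) (V : Del.Val n) →
    transV (Del.renV ρ V) ≡ Eff.renV ρ (transV V)
  transV-renV ρ (Del.var i)    = refl
  transV-renV ρ Del.unit       = refl
  transV-renV ρ (Del.pair V W) = cong₂ Eff.pair (transV-renV ρ V) (transV-renV ρ W)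
  transV-renV ρ (Del.inj ℓ V)  = cong (Eff.inj ℓ) (transV-renV ρ V)
  transV-renV ρ (Del.thunk M)  = cong Eff.thunk (transC-renC ρ M)

  transC-renC : ∀ {n m} (ρ : Ren n m) (M : Del.Comp n) →
    transC (Del.renC ρ M) ≡ Eff.renC ρ (transC M)
  transC-renC ρ (Del.split V M)  = cong₂ Eff.split (transV-renV ρ V) (transC-renC (ext (ext ρ)) M)
  transC-renC ρ (Del.case V bs)  = cong₂ Eff.case (transV-renV ρ V) (transB-renB ρ bs)
  transC-renC ρ (Del.force V)    = cong Eff.force (transV-renV ρ V)
  transC-renC ρ (Del.ret V)      = cong Eff.ret (transV-renV ρ V)
  transC-renC ρ (Del.bind M N)   = cong₂ Eff.bind (transC-renC ρ M) (transC-renC (ext ρ) N)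
  transC-renC ρ (Del.lam M)      = cong Eff.lam (transC-renC (ext ρ) M)
  transC-renC ρ (Del.app M V)    = cong₂ Eff.app (transC-renC ρ M) (transV-renV ρ V)
  transC-renC ρ (Del.pairC M N)  = cong₂ Eff.pairC (transC-renC ρ M) (transC-renC ρ N)
  transC-renC ρ (Del.prj₁ M)     = cong Eff.prj₁ (transC-renC ρ M)
  transC-renC ρ (Del.prj₂ M)     = cong Eff.prj₂ (transC-renC ρ M)
  transC-renC ρ (Del.shift0 M)   =
    cong (λ M* → Eff.op shift0op (Eff.thunk (Eff.lam M*))) (transC-renC (ext ρ) M)
  transC-renC ρ (Del.reset M N)  =
    cong₂ (λ M* N* → Eff.handle M* (Eff.handler N* _)) (transC-renC ρ M) (transC-renC (ext ρ) N)

  transB-renB : ∀ {n m} (ρ : Ren n m) (bs : Del.Branches n) →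
    transB (Del.renB ρ bs) ≡ Eff.renB ρ (transB bs)
  transB-renB ρ Del.[]               = refl
  transB-renB ρ (Del._↦_∷_ ℓ M bs) = cong₂ (Eff._↦_∷_ ℓ) (transC-renC (ext ρ) M) (transB-renB ρ bs)

TranslatesSub : ∀ {n m} → Del.Sub n m → Eff.Sub n m → Set
TranslatesSub σ τ = ∀ i → τ i ≡ transV (σ i)

exts-translatesSub : ∀ {n m} {σ : Del.Sub n m} {τ : Eff.Sub n m} →
  TranslatesSub σ τ → TranslatesSub (Del.exts σ) (Eff.exts τ)
exts-translatesSub        στ zero    = refl
exts-translatesSub {σ = σ} στ (suc i) = trans (cong (Eff.renV suc) (στ i)) (sym (transV-renV suc (σ i)))

mutual
  transV-subV : ∀ {n m} {σ : Del.Sub n m} {τ : Eff.Sub n m} → TranslatesSub σ τ →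
    (V : Del.Val n) → transV (Del.subV σ V) ≡ Eff.subV τ (transV V)
  transV-subV στ (Del.var i)    = sym (στ i)
  transV-subV στ Del.unit       = refl
  transV-subV στ (Del.pair V W) = cong₂ Eff.pair (transV-subV στ V) (transV-subV στ W)
  transV-subV στ (Del.inj ℓ V)  = cong (Eff.inj ℓ) (transV-subV στ V)
  transV-subV στ (Del.thunk M)  = cong Eff.thunk (transC-subC στ M)

  transC-subC : ∀ {n m} {σ : Del.Sub n m} {τ : Eff.Sub n m} → TranslatesSub σ τ →
    (M : Del.Comp n) → transC (Del.subC σ M) ≡ Eff.subC τ (transC M)
  transC-subC στ (Del.split V M)  =
    cong₂ Eff.split (transV-subV στ V) (transC-subC (exts-translatesSub (exts-translatesSub στ)) M)
  transC-subC στ (Del.case V bs)  = cong₂ Eff.case (transV-subV στ V) (transB-subB στ bs)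
  transC-subC στ (Del.force V)    = cong Eff.force (transV-subV στ V)
  transC-subC στ (Del.ret V)      = cong Eff.ret (transV-subV στ V)
  transC-subC στ (Del.bind M N)   = cong₂ Eff.bind (transC-subC στ M) (transC-subC (exts-translatesSub στ) N)
  transC-subC στ (Del.lam M)      = cong Eff.lam (transC-subC (exts-translatesSub στ) M)
  transC-subC στ (Del.app M V)    = cong₂ Eff.app (transC-subC στ M) (transV-subV στ V)
  transC-subC στ (Del.pairC M N)  = cong₂ Eff.pairC (transC-subC στ M) (transC-subC στ N)
  transC-subC στ (Del.prj₁ M)     = cong Eff.prj₁ (transC-subC στ M)
  transC-subC στ (Del.prj₂ M)     = cong Eff.prj₂ (transC-subC στ M)
  transC-subC στ (Del.shift0 M)   =
    cong (λ M* → Eff.op shift0op (Eff.thunk (Eff.lam M*))) (transC-subC (exts-translatesSub στ) M)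
  transC-subC στ (Del.reset M N)  =
    cong₂ (λ M* N* → Eff.handle M* (Eff.handler N* _))
          (transC-subC στ M) (transC-subC (exts-translatesSub στ) N)

  transB-subB : ∀ {n m} {σ : Del.Sub n m} {τ : Eff.Sub n m} → TranslatesSub σ τ →
    (bs : Del.Branches n) → transB (Del.subB σ bs) ≡ Eff.subB τ (transB bs)
  transB-subB στ Del.[]               = refl
  transB-subB στ (Del._↦_∷_ ℓ M bs) =
    cong₂ (Eff._↦_∷_ ℓ) (transC-subC (exts-translatesSub στ) M) (transB-subB στ bs)

transC-[]₁ : ∀ {n} (M : Del.Comp (suc n)) (V : Del.Val n) →
  transC (M Del.[ V ]₁) ≡ transC M Eff.[ transV V ]₁
transC-[]₁ M V = transC-subC (λ { zero → refl ; (suc i) → refl }) M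

transC-[,]₂ : ∀ {n} (M : Del.Comp (suc (suc n))) (V W : Del.Val n) →
  transC (M Del.[ V , W ]₂) ≡ transC M Eff.[ transV V , transV W ]₂
transC-[,]₂ M V W = transC-subC (λ { zero → refl ; (suc zero) → refl ; (suc (suc i)) → refl }) M

lookupB-transB : ∀ {n} ℓ (bs : Del.Branches n) {M} →
  Del.lookupB ℓ bs ≡ just M → Eff.lookupB ℓ (transB bs) ≡ just (transC M)
lookupB-transB ℓ (Del._↦_∷_ ℓ' M bs) eq with ℓ ≟ ℓ'
lookupB-transB ℓ (Del._↦_∷_ ℓ' M bs) refl | yes _ = refl
... | no _ = lookupB-transB ℓ bs eq

transBF : ∀ {n} → Del.BFrame n → Eff.BFrame n
transBF (Del.bindF N) = Eff.bindF (transC N)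
transBF (Del.appF V)  = Eff.appF (transV V)
transBF Del.prj₁F     = Eff.prj₁F
transBF Del.prj₂F     = Eff.prj₂F

transH : ∀ {n} → Del.HCtx n → Eff.HCtx n
transH []      = []
transH (B ∷ H) = transBF B ∷ transH H

shift0Handler : ∀ {n} → Del.Comp (suc n) → Eff.Handler n
shift0Handler N = Eff.handler (transC N)
  (Eff._↦_∷_ shift0op (Eff.app (Eff.force (Eff.var zero)) (Eff.var (suc zero))) Eff.[])

transEF : ∀ {n} → Del.EFrame n → Eff.EFrame n
transEF (Del.basic B)  = Eff.basic (transBF B)
transEF (Del.resetF N) = Eff.handleF (shift0Handler N)

transK : ∀ {n} → Del.ECtx n → Eff.ECtx n
transK []      = []
transK (F ∷ K) = transEF F ∷ transK K

transC-plugB : ∀ {n} (B : Del.BFrame n) (M : Del.Comp n) →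
  transC (Del.plugB B M) ≡ Eff.plugB (transBF B) (transC M)
transC-plugB (Del.bindF N) M = refl
transC-plugB (Del.appF V)  M = refl
transC-plugB Del.prj₁F     M = refl
transC-plugB Del.prj₂F     M = refl

transC-plugH : ∀ {n} (H : Del.HCtx n) (M : Del.Comp n) →
  transC (Del.plugH H M) ≡ Eff.plugH (transH H) (transC M)
transC-plugH []      M = refl
transC-plugH (B ∷ H) M =
  trans (transC-plugH H (Del.plugB B M)) (cong (Eff.plugH (transH H)) (transC-plugB B M))

transC-plugE : ∀ {n} (K : Del.ECtx n) (M : Del.Comp n) →
  transC (Del.plugE K M) ≡ Eff.plugE (transK K) (transC M)
transC-plugE []                 M = refl
transC-plugE (Del.basic B ∷ K)  M =
  trans (transC-plugE K (Del.plugB B M)) (cong (Eff.plugE (transK K)) (transC-plugB B M))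
transC-plugE (Del.resetF N ∷ K) M = transC-plugE K (Del.reset M N)

transBF-renBF : ∀ {n m} (ρ : Ren n m) (B : Del.BFrame n) →
  transBF (Del.renBF ρ B) ≡ Eff.renBF ρ (transBF B)
transBF-renBF ρ (Del.bindF N) = cong Eff.bindF (transC-renC (ext ρ) N)
transBF-renBF ρ (Del.appF V)  = cong Eff.appF (transV-renV ρ V)
transBF-renBF ρ Del.prj₁F     = refl
transBF-renBF ρ Del.prj₂F     = refl

transH-renH : ∀ {n m} (ρ : Ren n m) (H : Del.HCtx n) →
  transH (Del.renH ρ H) ≡ Eff.renH ρ (transH H)
transH-renH ρ []      = refl
transH-renH ρ (B ∷ H) = cong₂ _∷_ (transBF-renBF ρ B) (transH-renH ρ H)

shiftContinuation : ∀ {n} → Del.HCtx n → Del.Comp (suc n) → Del.Val n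
shiftContinuation H N =
  Del.thunk (Del.lam (Del.reset (Del.plugH (Del.renH suc H) (Del.ret (Del.var zero))) (Del.renC (ext suc) N)))

handlerContinuation : ∀ {n} → Eff.HCtx n → Eff.Handler n → Eff.Val n
handlerContinuation H h =
  Eff.thunk (Eff.lam (Eff.handle (Eff.plugH (Eff.renH suc H) (Eff.ret (Eff.var zero))) (Eff.renHd suc h)))

transV-continuation : ∀ {n} (H : Del.HCtx n) (N : Del.Comp (suc n)) →
  transV (shiftContinuation H N) ≡ handlerContinuation (transH H) (shift0Handler N)
transV-continuation H N =
  cong₂ (λ H* N* → Eff.thunk (Eff.lam (Eff.handle H* (Eff.handler N* _))))
        (trans (transC-plugH (Del.renH suc H) _) (cong (λ H* → Eff.plugH H* _) (transH-renH suc H)))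
        (transC-renC (ext suc) N)

step⁺ : ∀ {n} (K : Eff.ECtx n) {M N : Eff.Comp n} →
  M Eff.→β N → TransClosure Eff._⟶_ (Eff.plugE K M) (Eff.plugE K N)
step⁺ K r = [ Eff.step K r ]

shift-simulation : ∀ {n} (K : Eff.ECtx n) (H : Del.HCtx n) (M : Del.Comp (suc n)) (N : Del.Comp (suc n)) →
  TransClosure Eff._⟶_
    (Eff.plugE K (transC (Del.reset (Del.plugH H (Del.shift0 M)) N)))
    (Eff.plugE K (transC (M Del.[ shiftContinuation H N ]₁)))
shift-simulation K H M N
  rewrite transC-plugH H (Del.shift0 M)
        | transC-[]₁ M (shiftContinuation H N)
        | transV-continuation H N
  = Eff.step K (Eff.β-op (transH H) refl)
  ∷ Eff.step (Eff.basic (Eff.appF _) ∷ K) Eff.β-force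
  ∷ step⁺ K Eff.β-lam

β-simulation : ∀ {n} {M N : Del.Comp n} → M Del.→β N → (K : Eff.ECtx n) →
  TransClosure Eff._⟶_ (Eff.plugE K (transC M)) (Eff.plugE K (transC N))
β-simulation (Del.β-split {V₁} {V₂} {M}) K rewrite transC-[,]₂ M V₁ V₂ = step⁺ K Eff.β-split
β-simulation (Del.β-case {ℓ} {V} {bs} {M} eq) K rewrite transC-[]₁ M V =
  step⁺ K (Eff.β-case (lookupB-transB ℓ bs eq))
β-simulation Del.β-force                  K = step⁺ K Eff.β-force
β-simulation (Del.β-bind {V} {N})         K rewrite transC-[]₁ N V = step⁺ K Eff.β-bind
β-simulation (Del.β-lam {M} {V})          K rewrite transC-[]₁ M V = step⁺ K Eff.β-lam
β-simulation Del.β-prj₁                   K = step⁺ K Eff.β-prj₁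
β-simulation Del.β-prj₂                   K = step⁺ K Eff.β-prj₂
β-simulation (Del.β-ret {V} {N})          K rewrite transC-[]₁ N V = step⁺ K Eff.β-ret
β-simulation (Del.β-shift H {M} {N})      K = shift-simulation K H M N

theorem6p6 : ∀ {n} {M N : Del.Comp n} → M Del.⟶ N → TransClosure Eff._⟶_ (transC M) (transC N)
theorem6p6 (Del.step K {M} {N} r) rewrite transC-plugE K M | transC-plugE K N = β-simulation r (transK K)
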